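{- For every maximal clique-partition $\mathcal{P}$ of $G$ there is exactly one configuration $\mathit{cfg}\in\Pi^!_{\mathit{mcp}}(G)$ with $\mathit{repr}(\mathit{cfg})=\mathcal{P}$.
   Context: Let $G=(V,E)$ be a finite undirected graph. A clique is a nonempty set of pairwise adjacent vertices; it is maximal if not properly contained in another clique. A clique-partition of $G$ is a partition of $V$ into cliques; it is maximal if it does not contain two different cliques $C,C'$ with $C\cup C'$ a clique. Fix an enumeration $\overline{C}_1,\ldots,\overline{C}_m$ of all maximal cliques of $G$. For $v\in V$ let $\mathit{cliques}(v):=\{i\in[m]\mid v\in\overline{C}_i\}$, and for nonempty $C\subseteq V$ let $\mathit{cliques}(C):=\bigcap_{v\in C}\mathit{cliques}(v)$. A configuration is a list $[C_1,\ldots,C_m]$ where each $C_i$ is empty or a clique, $C_i\subseteq\overline{C}_i$, and $\bigcup_i C_i=V$; $\mathit{repr}([C_1,\ldots,C_m]):=\{C_i\mid C_i\neq\emptyset\}$. $\Pi_{\mathit{mcp}}(G)$ is the set of configurations whose $\mathit{repr}$ is a maximal clique-partition of $G$, and $\Pi^!_{\mathit{mcp}}(G)$ is the set of configurations $[C_1,\ldots,C_m]\in\Pi_{\mathit{mcp}}(G)$ such that for all $1\le j<i\le m$, if $C_j\neq\emptyset$ then $i\notin\mathit{cliques}(C_j)$. -}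

module Defs where

open import Data.Nat using (ℕ)
open import Data.Fin using (Fin; _<_)
open import Data.Fin.Subset using (Subset; _∈_; _∉_; _⊆_; _∪_; Nonempty; Empty)
open import Data.Product using (Σ; ∃; _×_; _,_)
open import Data.Sum using (_⊎_)
open import Relation.Nullary using (¬_)
open import Relation.Binary using (Decidable)
open import Relation.Binary.PropositionalEquality using (_≡_; _≢_)

record Graph (n : ℕ) : Set₁ where
  field
    Adj     : Fin n → Fin n → Set
    Adj-sym : ∀ {u v} → Adj u v → Adj v u
    Adj?    : Decidable Adj
open Graph public

module _ {n : ℕ} (G : Graph n) where

  IsClique : Subset n → Set
  IsClique C = Nonempty C × (∀ {u v} → u ∈ C → v ∈ C → u ≢ v → Adj G u v)

  IsMaximalClique : Subset n → Set
  IsMaximalClique C = IsClique C × (∀ D → IsClique D → C ⊆ D → D ⊆ C)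

  Family : Set₁
  Family = Subset n → Set

  IsCliquePartition : Family → Set
  IsCliquePartition P =
    (∀ S → P S → IsClique S) ×
    (∀ S T → P S → P T → S ≢ T → ∀ v → v ∈ S → v ∉ T) ×
    (∀ v → ∃ λ S → P S × v ∈ S)

  IsMaximalCliquePartition : Family → Set
  IsMaximalCliquePartition P =
    IsCliquePartition P ×
    (∀ S T → P S → P T → S ≢ T → ¬ IsClique (S ∪ T))

  record MaxCliqueEnum (m : ℕ) : Set where
    field
      C̄         : Fin m → Subset n
      C̄-maximal : ∀ i → IsMaximalClique (C̄ i)
      C̄-all     : ∀ C → IsMaximalClique C → ∃ λ i → C̄ i ≡ C
      C̄-inj     : ∀ i j → C̄ i ≡ C̄ j → i ≡ j
  open MaxCliqueEnum public

  SameFamily : Family → Family → Set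
  SameFamily P Q = ∀ S → (P S → Q S) × (Q S → P S)

  module _ {m : ℕ} (en : MaxCliqueEnum m) where

    -- i ∈ cliques(C)  iff  C ⊆ C̄ᵢ   (for nonempty C)
    _∈cliques_ : Fin m → Subset n → Set
    i ∈cliques C = C ⊆ C̄ en i

    IsConfiguration : (Fin m → Subset n) → Set
    IsConfiguration C =
      (∀ i → Empty (C i) ⊎ IsClique (C i)) ×
      (∀ i → C i ⊆ C̄ en i) ×
      (∀ v → ∃ λ i → v ∈ C i)

    repr : (Fin m → Subset n) → Family
    repr C S = Nonempty S × (∃ λ i → C i ≡ S)

    InΠmcp : (Fin m → Subset n) → Set
    InΠmcp C = IsConfiguration C × IsMaximalCliquePartition (repr C)

    InΠ!mcp : (Fin m → Subset n) → Set
    InΠ!mcp C = InΠmcp C ×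
      (∀ j i → j < i → Nonempty (C j) → ¬ (i ∈cliques (C j)))

-- Every part S of the partition lies in some maximal clique (extend it greedily), so there is a
-- largest index i with S ⊆ C̄ᵢ, and S can only be placed at that index: the condition defining Π!
-- says precisely that each nonempty entry C_i sits at the largest index i with C_i ⊆ C̄ᵢ. Placing
-- every part this way is possible because two distinct parts never share this index: both would
-- lie in C̄ᵢ, so their union would be a clique, contradicting maximality of the partition.
module Submission where

open import Defs
open import Data.Nat using (ℕ; s≤s)
open import Data.Fin using (Fin; zero; suc; _<_; _≟_; _<?_)
open import Data.Fin.Subset using (Subset; _∈_; _⊆_; _∪_; ⁅_⁆; ⊥; Nonempty; Empty)
open import Data.Fin.Subset.Properties
  using (_∈?_; _⊆?_; nonempty?; Empty-unique; ∉⊥; x∈⁅x⁆; x∈⁅y⁆⇒x≡y; p⊆p∪q; x∈p∪q⁻; x∈p∪q⁺)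
open import Data.Fin.Properties using (any?; all?; <-cmp)
open import Data.Product using (Σ; ∃; _×_; _,_; proj₁; proj₂)
open import Data.Sum using (_⊎_; inj₁; inj₂; [_,_]; map₂)
open import Data.Empty using (⊥-elim)
open import Data.List using (List; []; _∷_; allFin)
import Data.List.Membership.Propositional as List
open import Data.List.Membership.Propositional.Properties using (∈-allFin)
open import Data.List.Relation.Unary.Any using (here; there)
import Data.Bool as Bool
open import Data.Vec.Properties using (≡-dec)
open import Relation.Nullary using (¬_; Dec; yes; no; ¬?)
open import Relation.Nullary.Decidable using (_→-dec_; _×-dec_)
open import Relation.Unary using (Pred; Decidable)
open import Relation.Binary using (tri<; tri≈; tri>)
open import Relation.Binary.PropositionalEquality using (_≡_; _≢_; refl; sym; trans; subst)

_≟ₛ_ : ∀ {n} (S T : Subset n) → Dec (S ≡ T)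
_≟ₛ_ = ≡-dec Bool._≟_

last-witness : ∀ {m ℓ} {Q : Pred (Fin m) ℓ} → Decidable Q → ∃ Q →
               ∃ λ i → Q i × (∀ j → i < j → ¬ Q j)
last-witness {ℕ.suc m} Q? (i , qi) with any? (λ k → Q? (suc k))
... | yes later with last-witness (λ k → Q? (suc k)) later
...   | j , qj , after = suc j , qj , λ { (suc k) (s≤s j<k) → after k j<k }
last-witness {ℕ.suc m} Q? (zero  , q₀) | no none = zero , q₀ , λ { (suc k) _ qk → none (k , qk) }
last-witness {ℕ.suc m} Q? (suc i , qi) | no none = ⊥-elim (none (i , qi))

module _ {n : ℕ} (G : Graph n) where

  clique-⊆ : ∀ {C S} → IsClique G C → Nonempty S → S ⊆ C → IsClique G S
  clique-⊆ (_ , adj) ne S⊆C = ne , λ u∈S v∈S u≢v → adj (S⊆C u∈S) (S⊆C v∈S) u≢v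

  Addable : Subset n → Fin n → Set
  Addable D w = ∀ u → u ∈ D → u ≢ w → Adj G u w

  addable? : ∀ D w → Dec (Addable D w)
  addable? D w = all? (λ u → (u ∈? D) →-dec (¬? (u ≟ w) →-dec Adj? G u w))

  clique-∪⁅⁆ : ∀ {D w} → IsClique G D → Addable D w → IsClique G (D ∪ ⁅ w ⁆)
  clique-∪⁅⁆ {D} {w} ((x , x∈D) , adj) addable = (x , p⊆p∪q ⁅ w ⁆ x∈D) , adj′
    where
    adj′ : ∀ {u v} → u ∈ D ∪ ⁅ w ⁆ → v ∈ D ∪ ⁅ w ⁆ → u ≢ v → Adj G u v
    adj′ {u} {v} u∈ v∈ u≢v with x∈p∪q⁻ D ⁅ w ⁆ u∈ | x∈p∪q⁻ D ⁅ w ⁆ v∈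
    ... | inj₁ u∈D | inj₁ v∈D = adj u∈D v∈D u≢v
    ... | inj₁ u∈D | inj₂ v∈w with x∈⁅y⁆⇒x≡y w v∈w
    ...   | refl = addable u u∈D u≢v
    adj′ u∈ v∈ u≢v | inj₂ u∈w | inj₁ v∈D with x∈⁅y⁆⇒x≡y w u∈w
    ...   | refl = Adj-sym G (addable _ v∈D (λ v≡u → u≢v (sym v≡u)))
    adj′ u∈ v∈ u≢v | inj₂ u∈w | inj₂ v∈w with x∈⁅y⁆⇒x≡y w u∈w | x∈⁅y⁆⇒x≡y w v∈w
    ...   | refl | refl = ⊥-elim (u≢v refl)

  insertIfAddable : Subset n → Fin n → Subset n
  insertIfAddable D w with addable? D w
  ... | yes _ = D ∪ ⁅ w ⁆
  ... | no  _ = D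

  ⊆-insertIfAddable : ∀ D w → D ⊆ insertIfAddable D w
  ⊆-insertIfAddable D w with addable? D w
  ... | yes _ = p⊆p∪q ⁅ w ⁆
  ... | no  _ = λ x∈D → x∈D

  insertIfAddable-clique : ∀ {D} w → IsClique G D → IsClique G (insertIfAddable D w)
  insertIfAddable-clique {D} w clD with addable? D w
  ... | yes addable = clique-∪⁅⁆ clD addable
  ... | no  _       = clD

  greedy : List (Fin n) → Subset n → Subset n
  greedy []       D = D
  greedy (w ∷ ws) D = greedy ws (insertIfAddable D w)

  ⊆-greedy : ∀ ws D → D ⊆ greedy ws D
  ⊆-greedy []       D x∈D = x∈D
  ⊆-greedy (w ∷ ws) D x∈D = ⊆-greedy ws _ (⊆-insertIfAddable D w x∈D)

  greedy-clique : ∀ ws {D} → IsClique G D → IsClique G (greedy ws D)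
  greedy-clique []       clD = clD
  greedy-clique (w ∷ ws) clD = greedy-clique ws (insertIfAddable-clique w clD)

  -- A vertex w of ws lying in a clique E ⊇ greedy ws D was addable when it was visited,
  -- because the set built so far was already contained in E.
  greedy-saturated : ∀ ws D {E} → IsClique G E → greedy ws D ⊆ E →
                     ∀ {w} → w List.∈ ws → w ∈ E → w ∈ greedy ws D
  greedy-saturated (w ∷ ws) D clE sub (here refl) w∈E with addable? D w
  ... | yes _ = ⊆-greedy ws _ (x∈p∪q⁺ (inj₂ (x∈⁅x⁆ w)))
  ... | no not-addable =
    ⊥-elim (not-addable λ u u∈D u≢w → proj₂ clE (sub (⊆-greedy ws D u∈D)) w∈E u≢w)
  greedy-saturated (x ∷ ws) D clE sub (there w∈ws) w∈E =
    greedy-saturated ws (insertIfAddable D x) clE sub w∈ws w∈E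

  extend-to-maximal : ∀ {S} → IsClique G S → ∃ λ D → IsMaximalClique G D × S ⊆ D
  extend-to-maximal {S} clS =
    greedy (allFin n) S ,
    (greedy-clique (allFin n) clS ,
     λ E clE sub w∈E → greedy-saturated (allFin n) S clE sub (∈-allFin _) w∈E) ,
    ⊆-greedy (allFin n) S

  maximalCliquePartition-resp-SameFamily : ∀ {P Q} → SameFamily G Q P →
    IsMaximalCliquePartition G P → IsMaximalCliquePartition G Q
  maximalCliquePartition-resp-SameFamily {P} {Q} Q≈P ((cliques , disjoint , cover) , maximal) =
    ((λ S QS → cliques S (to QS)) ,
     (λ S T QS QT → disjoint S T (to QS) (to QT)) ,
     (λ v → let (S , PS , v∈S) = cover v in S , proj₂ (Q≈P S) PS , v∈S)) ,
    (λ S T QS QT → maximal S T (to QS) (to QT))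
    where
    to : ∀ {S} → Q S → P S
    to {S} = proj₁ (Q≈P S)

  module _ {m : ℕ} (en : MaxCliqueEnum G m) where

    LastClique : Subset n → Fin m → Set
    LastClique S i = S ⊆ C̄ en i × (∀ j → i < j → ¬ S ⊆ C̄ en j)

    lastClique? : ∀ S i → Dec (LastClique S i)
    lastClique? S i = (S ⊆? C̄ en i) ×-dec all? (λ j → (i <? j) →-dec ¬? (S ⊆? C̄ en j))

    lastClique-unique : ∀ {S i j} → LastClique S i → LastClique S j → i ≡ j
    lastClique-unique {i = i} {j} (S⊆i , after-i) (S⊆j , after-j) with <-cmp i j
    ... | tri< i<j _ _ = ⊥-elim (after-i j i<j S⊆j)
    ... | tri≈ _ i≡j _ = i≡j
    ... | tri> _ _ j<i = ⊥-elim (after-j i j<i S⊆i)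

    lastClique-exists : ∀ {S} → IsClique G S → ∃ (LastClique S)
    lastClique-exists clS with extend-to-maximal clS
    ... | D , maxD , S⊆D with C̄-all en D maxD
    ...   | i , refl = last-witness (λ j → _ ⊆? C̄ en j) (i , S⊆D)

    module Placements {P : Family G} (mcp : IsMaximalCliquePartition G P) where

      private
        clique : ∀ {S} → P S → IsClique G S
        clique {S} = proj₁ (proj₁ mcp) S

        disjoint : ∀ S T → P S → P T → S ≢ T → ∀ v → v ∈ S → ¬ v ∈ T
        disjoint = proj₁ (proj₂ (proj₁ mcp))

        cover : ∀ v → ∃ λ S → P S × v ∈ S
        cover = proj₂ (proj₂ (proj₁ mcp))

        part : Fin n → Subset n
        part v = proj₁ (cover v)

        P-part : ∀ v → P (part v)
        P-part v = proj₁ (proj₂ (cover v))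

        ∈-part : ∀ v → v ∈ part v
        ∈-part v = proj₂ (proj₂ (cover v))

      record Placement (c : Fin m → Subset n) : Set where
        field
          placed   : ∀ i → Empty (c i) ⊎ (P (c i) × LastClique (c i) i)
          complete : ∀ S → P S → ∃ λ i → c i ≡ S
      open Placement

      placement-at : ∀ {c S i} → Placement c → P S → LastClique S i → c i ≡ S
      placement-at pl PS last-i with complete pl _ PS
      ... | k , refl with placed pl k
      ...   | inj₁ empty = ⊥-elim (empty (proj₁ (clique PS)))
      ...   | inj₂ (_ , last-k) with lastClique-unique last-k last-i
      ...     | refl = refl

      placement-unique : ∀ {c c′} → Placement c → Placement c′ → ∀ i → c′ i ≡ c i
      placement-unique pl pl′ i with placed pl i | placed pl′ i
      ... | inj₂ (PS , last) | _                  = placement-at pl′ PS last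
      ... | inj₁ _           | inj₂ (PS′ , last′) = sym (placement-at pl PS′ last′)
      ... | inj₁ empty       | inj₁ empty′        = trans (Empty-unique empty′) (sym (Empty-unique empty))

      placement⇒Π! : ∀ {c} → Placement c → InΠ!mcp G en c × SameFamily G (repr G en c) P
      placement⇒Π! {c} pl =
        ((configuration , maximalCliquePartition-resp-SameFamily same mcp) , after) , same
        where
        configuration : IsConfiguration G en c
        configuration =
          (λ i → map₂ (λ (PS , _) → clique PS) (placed pl i)) ,
          (λ i → [ (λ empty x∈ → ⊥-elim (empty (_ , x∈))) , (λ (_ , last) → proj₁ last) ] (placed pl i)) ,
          (λ v → let (i , ci≡part) = complete pl (part v) (P-part v)
                 in i , subst (v ∈_) (sym ci≡part) (∈-part v))

        same : SameFamily G (repr G en c) P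
        same S = to , λ PS → proj₁ (clique PS) , complete pl S PS
          where
          to : repr G en c S → P S
          to (ne , i , refl) with placed pl i
          ... | inj₁ empty    = ⊥-elim (empty ne)
          ... | inj₂ (PS , _) = PS

        after : ∀ j i → j < i → Nonempty (c j) → ¬ (c j ⊆ C̄ en i)
        after j i j<i ne with placed pl j
        ... | inj₁ empty          = ⊥-elim (empty ne)
        ... | inj₂ (_ , _ , last) = last i j<i

      Π!⇒placement : ∀ {c} → InΠ!mcp G en c → SameFamily G (repr G en c) P → Placement c
      placed (Π!⇒placement {c} (((_ , ⊆C̄ , _) , _) , after) same) i with nonempty? (c i)
      ... | no  empty = inj₁ empty
      ... | yes ne    = inj₂ (proj₁ (same (c i)) (ne , i , refl) , ⊆C̄ i , λ j i<j → after i j i<j ne)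
      complete (Π!⇒placement _ same) S PS = proj₂ (proj₂ (same S) PS)

      part-unique : ∀ {S v} → P S → v ∈ S → S ≡ part v
      part-unique {S} {v} PS v∈S with S ≟ₛ part v
      ... | yes S≡part = S≡part
      ... | no  S≢part = ⊥-elim (disjoint S (part v) PS (P-part v) S≢part v v∈S (∈-part v))

      lastClique-injective : ∀ {S T i} → P S → P T → LastClique S i → LastClique T i → S ≡ T
      lastClique-injective {S} {T} {i} PS PT (S⊆C̄ , _) (T⊆C̄ , _) with S ≟ₛ T
      ... | yes S≡T = S≡T
      ... | no  S≢T with clique PS
      ...   | (x , x∈S) , _ = ⊥-elim (proj₂ mcp S T PS PT S≢T
                                (clique-⊆ (proj₁ (C̄-maximal en i)) (x , p⊆p∪q T x∈S) S∪T⊆C̄))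
        where
        S∪T⊆C̄ : S ∪ T ⊆ C̄ en i
        S∪T⊆C̄ u∈ = [ S⊆C̄ , T⊆C̄ ] (x∈p∪q⁻ S T u∈)

      canonical : Fin m → Subset n
      canonical i with any? (λ v → lastClique? (part v) i)
      ... | yes (v , _) = part v
      ... | no  _       = ⊥

      canonical-at : ∀ {S i} → P S → LastClique S i → canonical i ≡ S
      canonical-at {S} {i} PS last with any? (λ v → lastClique? (part v) i)
      ... | yes (v , last-v) = lastClique-injective (P-part v) PS last-v last
      ... | no  none with clique PS
      ...   | (x , x∈S) , _ = ⊥-elim (none (x , subst (λ T → LastClique T i) (part-unique PS x∈S) last))

      canonical-placement : Placement canonical
      placed canonical-placement i with any? (λ v → lastClique? (part v) i)
      ... | yes (v , last) = inj₂ (P-part v , last)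
      ... | no  _          = inj₁ λ (_ , x∈⊥) → ∉⊥ x∈⊥
      complete canonical-placement S PS =
        let (i , last) = lastClique-exists (clique PS) in i , canonical-at PS last

lemma5 : ∀ {n m} (G : Graph n) (en : MaxCliqueEnum G m) (P : Family G) →
    IsMaximalCliquePartition G P →
    Σ (Fin m → Subset n) (λ cfg →
    (InΠ!mcp G en cfg × SameFamily G (repr G en cfg) P) ×
    (∀ cfg′ → InΠ!mcp G en cfg′ → SameFamily G (repr G en cfg′) P →
    ∀ i → cfg′ i ≡ cfg i))
lemma5 G en P mcp =
  canonical ,
  placement⇒Π! canonical-placement ,
  λ cfg′ Π!′ same′ → placement-unique canonical-placement (Π!⇒placement {cfg′} Π!′ same′)
  where open Placements G en mcp
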